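{- Let $k,w,h$ be integers with $3\leq k\leq w$ and $h>1$. If $w$ and $h$ are both odd, then Maker has a winning strategy (playing first) in the $w\times h$ Connect-$k$ game in the Maker-Breaker convention.
   Context: A poset positional game is a triple $(X,\mathcal{F},P)$ with $X$ a finite board of vertices, $\mathcal{F}\subseteq 2^X$ the winning sets, and $P$ a partial order on $X$. Two players alternately claim an unclaimed vertex $v$ such that all vertices smaller than $v$ in $P$ are already claimed, until all vertices are claimed. In the Maker-Breaker convention, Maker wins if she claims all vertices of some winning set; otherwise Breaker wins. The $w\times h$ Connect-$k$ game is the poset positional game whose board is the grid $\{1,\dots,w\}\times\{1,\dots,h\}$ (columns and rows), whose poset consists of $w$ pairwise disjoint chains (the columns) with $(a,b)<(a,b')$ iff $b<b'$ (row $1$ is the bottom), and whose winning sets are all sets of $k$ consecutive grid positions aligned horizontally, vertically or diagonally. -}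

module Defs where

open import Data.Nat using (ℕ; zero; suc; _+_; _*_; _∸_; _<_; _≤_)
open import Data.Fin using (Fin; fromℕ<)
open import Data.List using (List; []; _∷_; _++_; [_]; length)
open import Data.Vec using (Vec; lookup; updateAt; replicate)
open import Data.Product using (Σ; ∃; ∃-syntax; _×_; _,_)
open import Data.Empty using (⊥)
open import Relation.Binary.PropositionalEquality using (_≡_)

Odd : ℕ → Set
Odd n = ∃[ m ] n ≡ 2 * m + 1

data Player : Set where
  maker breaker : Player

-- A position of the w × h Connect-k game: for each of the w columns
-- (0-indexed), the list of owners of its claimed cells, from the bottom
-- row (row 0) upwards. Because of the column-chain poset, the claimed
-- cells of a column are always an initial segment (bottom rows) of it.
Board : ℕ → Set
Board w = Vec (List Player) w

emptyBoard : (w : ℕ) → Board w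
emptyBoard w = replicate w []

ownedAt : List Player → ℕ → Player → Set
ownedAt []       _       _ = ⊥
ownedAt (x ∷ xs) zero    p = x ≡ p
ownedAt (x ∷ xs) (suc y) p = ownedAt xs y p

MakerOwns : {w : ℕ} → Board w → ℕ → ℕ → Set
MakerOwns {w} B x y = Σ (x < w) λ lt → ownedAt (lookup B (fromℕ< lt)) y maker

data Dir : Set where
  horizontal vertical diagonal antidiagonal : Dir

cell : ℕ → Dir → ℕ → ℕ → ℕ → ℕ × ℕ
cell k horizontal   a b i = a + i , b
cell k vertical     a b i = a , b + i
cell k diagonal     a b i = a + i , b + i
cell k antidiagonal a b i = a + i , b + ((k ∸ 1) ∸ i)

-- Lines sticking out of
-- the board can never be fully owned, so quantifying over all base points
-- is the same as quantifying over the winning sets inside the board.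
MakerCompleted : {w : ℕ} → ℕ → Board w → Set
MakerCompleted {w} k B =
  Σ ℕ λ a → Σ ℕ λ b → Σ Dir λ d →
    (i : ℕ) → i < k → MakerOwns B (Σ.proj₁ (cell k d a b i)) (Σ.proj₂ (cell k d a b i))

Legal : {w : ℕ} → ℕ → Board w → Fin w → Set
Legal h B c = length (lookup B c) < h

play : {w : ℕ} → Board w → Fin w → Player → Board w
play B c p = updateAt B c (λ col → col ++ [ p ])

-- MakerWins w h k p B : in the Maker-Breaker w × h Connect-k game, from
-- position B with player p to move, Maker has a winning strategy.
-- (Inductive characterisation of winning positions of a finite game:
--  Maker wins once she has claimed a whole winning set; otherwise the game
--  must continue, Maker needs some legal move keeping her winning, and
--  Breaker must have a legal move while all his legal moves keep Maker
--  winning. A full board without a Maker line is a Breaker win.)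
data MakerWins (w h k : ℕ) : Player → Board w → Set where
  completed   : ∀ {p B} → MakerCompleted k B → MakerWins w h k p B
  makerMove   : ∀ {B} (c : Fin w) → Legal h B c →
                MakerWins w h k breaker (play B c maker) →
                MakerWins w h k maker B
  breakerMove : ∀ {B} → (∃[ c ] Legal h B c) →
                ((c : Fin w) → Legal h B c → MakerWins w h k maker (play B c breaker)) →
                MakerWins w h k breaker B

-- Maker opens in some column and from then on answers every Breaker move
-- directly on top of it, except that when Breaker opens an empty column she
-- opens another one; as w is odd, the number of empty columns is even whenever
-- Breaker is to move, so one is always available. Every non-empty column is
-- then its bottom cell followed by Breaker-Maker pairs, hence of odd height, so
-- for odd h Maker's answer always fits. Consequently the third row is Maker's
-- wherever it is claimed, and since Breaker must keep moving while some column
-- is lower than three, the game reaches a position where that whole row, which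
-- contains k consecutive cells, is Maker's.
module Submission where

open import Defs
open import Data.Fin using (Fin; zero; suc; fromℕ<; _≟_)
open import Data.Fin.Properties using (all?; ¬∀⟶∃¬)
open import Data.List using (List; []; _∷_; _++_; [_]; length)
open import Data.List.Properties using (length-++)
open import Data.Nat using (ℕ; zero; suc; _+_; _*_; _∸_; _≤_; _<_; _≤?_; z≤n; s≤s; z<s)
open import Data.Nat.Induction using (<-wellFounded)
open import Data.Nat.Properties hiding (_≟_)
open import Algebra.Properties.CommutativeSemigroup +-commutativeSemigroup using (xy∙z≈zy∙x)
open import Data.Product using (_,_; ∃-syntax; proj₁; proj₂)
open import Data.Vec using (Vec; []; _∷_; lookup; updateAt; replicate; map; sum)
open import Data.Vec.Properties using (lookup∘updateAt; lookup∘updateAt′; updateAt-updateAt; lookup-replicate)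
open import Induction.WellFounded using (Acc; acc)
open import Relation.Nullary using (yes; no; ¬_)
open import Relation.Binary.PropositionalEquality hiding ([_])

total : {A : Set} {n : ℕ} → (A → ℕ) → Vec A n → ℕ
total g xs = sum (map g xs)

module _ {A : Set} (g : A → ℕ) where

  total-updateAt : ∀ {n} (xs : Vec A n) (i : Fin n) (f : A → A) →
                   total g (updateAt xs i f) + g (lookup xs i) ≡ total g xs + g (f (lookup xs i))
  total-updateAt (x ∷ xs) zero    f = xy∙z≈zy∙x (g (f x)) (total g xs) (g x)
  total-updateAt (x ∷ xs) (suc i) f = begin
    g x + total g (updateAt xs i f) + g (lookup xs i)   ≡⟨ +-assoc (g x) _ _ ⟩
    g x + (total g (updateAt xs i f) + g (lookup xs i)) ≡⟨ cong (g x +_) (total-updateAt xs i f) ⟩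
    g x + (total g xs + g (f (lookup xs i)))            ≡⟨ +-assoc (g x) _ _ ⟨
    g x + total g xs + g (f (lookup xs i))              ∎
    where open ≡-Reasoning

  total-updateAt-≡ : ∀ {n} (xs : Vec A n) (i : Fin n) {f : A → A} →
                     g (f (lookup xs i)) ≡ g (lookup xs i) → total g (updateAt xs i f) ≡ total g xs
  total-updateAt-≡ xs i {f} same = +-cancelʳ-≡ (g (lookup xs i)) _ _ (begin
    total g (updateAt xs i f) + g (lookup xs i) ≡⟨ total-updateAt xs i f ⟩
    total g xs + g (f (lookup xs i))            ≡⟨ cong (total g xs +_) same ⟩
    total g xs + g (lookup xs i)                ∎)
    where open ≡-Reasoning

  total-updateAt-< : ∀ {n} (xs : Vec A n) (i : Fin n) {f : A → A} →
                     g (f (lookup xs i)) < g (lookup xs i) → total g (updateAt xs i f) < total g xs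
  total-updateAt-< xs i {f} smaller = +-cancelʳ-< (g (lookup xs i)) _ _ (begin-strict
    total g (updateAt xs i f) + g (lookup xs i) ≡⟨ total-updateAt xs i f ⟩
    total g xs + g (f (lookup xs i))            <⟨ +-monoʳ-< (total g xs) smaller ⟩
    total g xs + g (lookup xs i)                ∎)
    where open ≤-Reasoning

  total-replicate : ∀ n (x : A) → total g (replicate n x) ≡ n * g x
  total-replicate zero    x = refl
  total-replicate (suc n) x = cong (g x +_) (total-replicate n x)

updateAt-preserves : ∀ {A : Set} {n} (P : A → Set) (xs : Vec A n) (i : Fin n) {f : A → A} →
                     (∀ j → P (lookup xs j)) → P (f (lookup xs i)) →
                     ∀ j → P (lookup (updateAt xs i f) j)
updateAt-preserves P xs i all Pfx j with j ≟ i
... | yes refl = subst P (sym (lookup∘updateAt j xs)) Pfx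
... | no j≢i   = subst P (sym (lookup∘updateAt′ j i j≢i xs)) (all j)

length-snoc : ∀ {A : Set} (xs : List A) (x : A) → length (xs ++ [ x ]) ≡ suc (length xs)
length-snoc xs x = trans (length-++ xs) (+-comm (length xs) 1)

Even : ℕ → Set
Even n = ∃[ e ] n ≡ 2 * e

even-suc⇒odd : ∀ {n} → Even (suc n) → Odd n
even-suc⇒odd {n} (suc e , eq) = e , suc-injective (begin
  suc n           ≡⟨ eq ⟩
  2 * suc e       ≡⟨ *-suc 2 e ⟩
  suc (1 + 2 * e) ≡⟨ cong suc (+-comm 1 (2 * e)) ⟩
  suc (2 * e + 1) ∎)
  where open ≡-Reasoning

odd-suc⇒even : ∀ {n} → Odd (suc n) → Even n
odd-suc⇒even (e , eq) = e , suc-injective (trans eq (+-comm (2 * e) 1))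

odd⇒pos : ∀ {n} → Odd n → 0 < n
odd⇒pos (e , refl) = subst (0 <_) (+-comm 1 (2 * e)) z<s

odd<odd⇒suc< : ∀ {m n} → Odd m → Odd n → m < n → suc m < n
odd<odd⇒suc< (a , refl) (b , refl) m<n = +-monoˡ-≤ 1 (begin
  2 + 2 * a ≡⟨ *-suc 2 a ⟨
  2 * suc a ≤⟨ *-monoʳ-≤ 2 a<b ⟩
  2 * b     ∎)
  where
  open ≤-Reasoning
  a<b : a < b
  a<b = *-cancelˡ-< 2 a b (+-cancelʳ-< 1 (2 * a) (2 * b) m<n)

odd>1⇒≥3 : ∀ {n} → Odd n → 1 < n → 3 ≤ n
odd>1⇒≥3 = odd<odd⇒suc< (0 , refl)

data Answered : List Player → Set where
  []     : Answered []
  answer : ∀ {ps} → Answered ps → Answered (breaker ∷ maker ∷ ps)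

data Tidy : List Player → Set where
  []  : Tidy []
  _∷_ : ∀ x {ps} → Answered ps → Tidy (x ∷ ps)

answered-snoc : ∀ {ps} → Answered ps → Answered ((ps ++ [ breaker ]) ++ [ maker ])
answered-snoc []          = answer []
answered-snoc (answer ps) = answer (answered-snoc ps)

odd-length : ∀ {ps} → Answered ps → Odd (suc (length ps))
odd-length []          = 0 , refl
odd-length (answer ps) with odd-length ps
... | j , eq = suc j , trans (cong (2 +_) eq) (cong (_+ 1) (sym (*-suc 2 j)))

tidy-row₂ : ∀ {col} → Tidy col → 3 ≤ length col → ownedAt col 2 maker
tidy-row₂ (x ∷ answer _) _         = refl
tidy-row₂ (x ∷ [])       (s≤s ())

emptyIndicator : List Player → ℕ
emptyIndicator []      = 1
emptyIndicator (_ ∷ _) = 0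

emptyColumns : ∀ {n} → Board n → ℕ
emptyColumns = total emptyIndicator

find-emptyColumn : ∀ {n} (B : Board n) → 0 < emptyColumns B → ∃[ c ] lookup B c ≡ []
find-emptyColumn ([] ∷ B)      _   = zero , refl
find-emptyColumn ((_ ∷ _) ∷ B) pos = let c , opened = find-emptyColumn B pos in suc c , opened

emptyColumns-open : ∀ {n} (B : Board n) c p → lookup B c ≡ [] →
                    suc (emptyColumns (play B c p)) ≡ emptyColumns B
emptyColumns-open ([] ∷ B)  zero    p refl   = refl
emptyColumns-open (col ∷ B) (suc c) p opened =
  trans (sym (+-suc _ _)) (cong (emptyIndicator col +_) (emptyColumns-open B c p opened))

emptyColumns-extend : ∀ {n} (B : Board n) c p {x xs} → lookup B c ≡ x ∷ xs →
                      emptyColumns (play B c p) ≡ emptyColumns B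
emptyColumns-extend B c p column = total-updateAt-≡ emptyIndicator B c
  (subst (λ col → emptyIndicator (col ++ [ p ]) ≡ emptyIndicator col) (sym column) refl)

module FollowUp {w h k : ℕ} (k≤w : k ≤ w) (odd-h : Odd h) (3≤h : 3 ≤ h) where

  freeCells : Board w → ℕ
  freeCells = total (λ col → h ∸ length col)

  AllTidy : Board w → Set
  AllTidy B = ∀ c → Tidy (lookup B c)

  freeCells-play : ∀ (B : Board w) c p → Legal h B c → freeCells (play B c p) < freeCells B
  freeCells-play B c p legal = total-updateAt-< _ B c
    (subst (λ l → h ∸ l < h ∸ length (lookup B c)) (sym (length-snoc (lookup B c) p))
      (∸-monoʳ-< ≤-refl legal))

  open-legal : ∀ (B : Board w) c → lookup B c ≡ [] → Legal h B c
  open-legal B c opened = subst (λ col → length col < h) (sym opened) (≤-trans (s≤s z≤n) 3≤h)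

  short-legal : ∀ (B : Board w) → ¬ (∀ c → 3 ≤ length (lookup B c)) → ∃[ c ] Legal h B c
  short-legal B short with ¬∀⟶∃¬ w _ (λ c → 3 ≤? length (lookup B c)) short
  ... | c , ¬tall = c , <-≤-trans (≰⇒> ¬tall) 3≤h

  row₂-complete : ∀ (B : Board w) → AllTidy B → (∀ c → 3 ≤ length (lookup B c)) →
                  MakerCompleted k B
  row₂-complete B tidy tall = 0 , 2 , horizontal , λ i i<k →
    let i<w = <-≤-trans i<k k≤w in i<w , tidy-row₂ (tidy (fromℕ< i<w)) (tall (fromℕ< i<w))

  WinsBelow : Board w → Set
  WinsBelow B = ∀ (B′ : Board w) → freeCells B′ < freeCells B →
                AllTidy B′ → Even (emptyColumns B′) → MakerWins w h k breaker B′

  answerOpening : ∀ (B : Board w) c → WinsBelow B → AllTidy B → Even (emptyColumns B) →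
                  lookup B c ≡ [] → MakerWins w h k maker (play B c breaker)
  answerOpening B c ih tidy even opened = makerMove c′ legal′ (ih B₂ fewer tidy₂ even₂)
    where
    B₁ : Board w
    B₁ = play B c breaker
    odd₁ : Odd (emptyColumns B₁)
    odd₁ = even-suc⇒odd (subst Even (sym (emptyColumns-open B c breaker opened)) even)
    another : ∃[ c′ ] lookup B₁ c′ ≡ []
    another = find-emptyColumn B₁ (odd⇒pos odd₁)
    c′ : Fin w
    c′ = proj₁ another
    legal′ : Legal h B₁ c′
    legal′ = open-legal B₁ c′ (proj₂ another)
    B₂ : Board w
    B₂ = play B₁ c′ maker
    fewer : freeCells B₂ < freeCells B
    fewer = <-trans (freeCells-play B₁ c′ maker legal′)
                    (freeCells-play B c breaker (open-legal B c opened))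
    tidy₁ : AllTidy B₁
    tidy₁ = updateAt-preserves Tidy B c tidy
              (subst (λ col → Tidy (col ++ [ breaker ])) (sym opened) (breaker ∷ []))
    tidy₂ : AllTidy B₂
    tidy₂ = updateAt-preserves Tidy B₁ c′ tidy₁
              (subst (λ col → Tidy (col ++ [ maker ])) (sym (proj₂ another)) (maker ∷ []))
    even₂ : Even (emptyColumns B₂)
    even₂ = odd-suc⇒even (subst Odd (sym (emptyColumns-open B₁ c′ maker (proj₂ another))) odd₁)

  answerOnTop : ∀ (B : Board w) c {x ps} → WinsBelow B → AllTidy B → Even (emptyColumns B) →
                lookup B c ≡ x ∷ ps → Answered ps → suc (length ps) < h →
                MakerWins w h k maker (play B c breaker)
  answerOnTop B c {x} {ps} ih tidy even column answered legal =
    makerMove c legal₁ (ih B₂ fewer tidy₂ even₂)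
    where
    B₁ B₂ : Board w
    B₁ = play B c breaker
    B₂ = play B₁ c maker
    column₁ : lookup B₁ c ≡ x ∷ ps ++ [ breaker ]
    column₁ = trans (lookup∘updateAt c B) (cong (_++ [ breaker ]) column)
    legal₁ : Legal h B₁ c
    legal₁ = subst (_< h) (sym (trans (cong length column₁) (cong suc (length-snoc ps breaker))))
               (odd<odd⇒suc< (odd-length answered) odd-h legal)
    fewer : freeCells B₂ < freeCells B
    fewer = <-trans (freeCells-play B₁ c maker legal₁)
                    (freeCells-play B c breaker (subst (λ col → length col < h) (sym column) legal))
    tidy₂ : AllTidy B₂
    tidy₂ = subst AllTidy (sym (updateAt-updateAt c B))
              (updateAt-preserves Tidy B c tidy
                (subst (λ col → Tidy ((col ++ [ breaker ]) ++ [ maker ])) (sym column)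
                  (x ∷ answered-snoc answered)))
    even₂ : Even (emptyColumns B₂)
    even₂ = subst Even (sym (trans (emptyColumns-extend B₁ c maker column₁)
                                   (emptyColumns-extend B c breaker column))) even

  breakerToMove : ∀ (B : Board w) → Acc _<_ (freeCells B) → AllTidy B → Even (emptyColumns B) →
                  MakerWins w h k breaker B
  breakerToMove B (acc below) tidy even with all? (λ c → 3 ≤? length (lookup B c))
  ... | yes tall  = completed (row₂-complete B tidy tall)
  ... | no short  = breakerMove (short-legal B short) reply
    where
    ih : WinsBelow B
    ih B′ fewer = breakerToMove B′ (below fewer)
    reply : ∀ c → Legal h B c → MakerWins w h k maker (play B c breaker)
    reply c legal with lookup B c in column | tidy c
    ... | []     | []           = answerOpening B c ih tidy even column
    ... | x ∷ ps | x ∷ answered = answerOnTop B c ih tidy even column answered legal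

  makerOpens : Odd w → MakerWins w h k maker (emptyBoard w)
  makerOpens odd-w = makerMove c₀ (open-legal B₀ c₀ opened₀)
                       (breakerToMove B₁ (<-wellFounded (freeCells B₁)) tidy₁ even₁)
    where
    c₀ : Fin w
    c₀ = fromℕ< (odd⇒pos odd-w)
    B₀ B₁ : Board w
    B₀ = emptyBoard w
    B₁ = play B₀ c₀ maker
    opened₀ : lookup B₀ c₀ ≡ []
    opened₀ = lookup-replicate c₀ []
    tidy₁ : AllTidy B₁
    tidy₁ = updateAt-preserves Tidy B₀ c₀ (λ c → subst Tidy (sym (lookup-replicate c [])) [])
              (subst (λ col → Tidy (col ++ [ maker ])) (sym opened₀) (maker ∷ []))
    even₁ : Even (emptyColumns B₁)
    even₁ = odd-suc⇒even (subst Odd (sym (trans (emptyColumns-open B₀ c₀ maker opened₀)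
              (trans (total-replicate emptyIndicator w []) (*-identityʳ w)))) odd-w)

corollary2 : (k w h : ℕ) → 3 ≤ k → k ≤ w → 1 < h → Odd w → Odd h →
             MakerWins w h k maker (emptyBoard w)
-- The strategy never needs k ≥ 3.
corollary2 k w h _ k≤w 1<h odd-w odd-h =
  FollowUp.makerOpens k≤w odd-h (odd>1⇒≥3 odd-h 1<h) odd-w
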